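{- Let $G$ be a Hamiltonian graph on at least $5$ vertices. Then $\text{BROADCAST}(G,2)$ is an Adversary win.
   Context: For a finite connected graph $G$ and an integer $k\ge 1$, $\text{BROADCAST}(G,k)$ is a game between a team of $k$ agents ("Agents") and "Adversary". Setup: Adversary places $k-1$ ignorant agents and $1$ knowledgeable agent on $k$ distinct vertices of $G$. At each time $t=1,2,\ldots$: first Adversary selects an arbitrary connected spanning subgraph $G_t$ of $G$; then each agent either stays at its vertex or moves to a vertex adjacent to it in $G_t$. If after this move several agents are located at the same vertex and at least one of them was knowledgeable at time $t-1$, all of them become knowledgeable at time $t$. Agents win if all agents become knowledgeable. The game is an Adversary win if Adversary has a strategy preventing all agents from ever becoming knowledgeable. -}

module Defs where

open import Data.Nat using (ℕ; zero; suc; _≤_)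
open import Data.Fin using (Fin; toℕ) renaming (_≟_ to _≟ᶠ_)
open import Data.Bool using (Bool; true; false; _∨_; _∧_)
open import Data.List using (List; []; _∷_; allFin; _++_; [_])
open import Data.Bool.ListAction using (any)
open import Data.Product using (Σ; _×_; ∃; ∃-syntax)
open import Data.Sum using (_⊎_)
open import Relation.Binary.PropositionalEquality using (_≡_)
open import Relation.Nullary using (¬_)
open import Relation.Nullary.Decidable using (⌊_⌋)
open import Function.Definitions using (Injective)

record Graph (n : ℕ) : Set₁ where
  field
    Adj     : Fin n → Fin n → Set
    symm    : ∀ {u v} → Adj u v → Adj v u
    irrefl  : ∀ {u} → ¬ Adj u u

data Reach {n : ℕ} (E : Fin n → Fin n → Set) : Fin n → Fin n → Set where
  here : ∀ {u} → Reach E u u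
  step : ∀ {u v w} → E u v → Reach E v w → Reach E u w

ConnectedRel : {n : ℕ} → (Fin n → Fin n → Set) → Set
ConnectedRel E = ∀ u v → Reach E u v

Connected : {n : ℕ} → Graph n → Set
Connected G = ConnectedRel (Graph.Adj G)

record ConnSpanningSubgraph {n : ℕ} (G : Graph n) : Set₁ where
  field
    E         : Fin n → Fin n → Set
    sub       : ∀ {u v} → E u v → Graph.Adj G u v
    symm      : ∀ {u v} → E u v → E v u
    connected : ConnectedRel E

-- G is Hamiltonian: it has a Hamiltonian cycle c 0, c 1, ..., c (n-1), c 0
-- (n ≥ 3, all vertices visited exactly once, consecutive vertices adjacent).
Hamiltonian : {n : ℕ} → Graph n → Set
Hamiltonian {n} G =
  3 ≤ n × Σ (Fin n → Fin n) (λ c →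
    Injective _≡_ _≡_ c ×
    (∀ (i j : Fin n) →
       (suc (toℕ i) ≡ toℕ j ⊎ (suc (toℕ i) ≡ n × toℕ j ≡ 0)) →
       Graph.Adj G (c i) (c j)))

Positions : ℕ → ℕ → Set
Positions k n = Fin k → Fin n

updateKnow : {k n : ℕ} → (Fin k → Bool) → Positions k n → Fin k → Bool
updateKnow {k} κ p' i = κ i ∨ any (λ j → ⌊ p' j ≟ᶠ p' i ⌋ ∧ κ j) (allFin k)

LegalMove : {k n : ℕ} {G : Graph n} → ConnSpanningSubgraph G →
            Positions k n → Positions k n → Set
LegalMove H p p' = ∀ i → p' i ≡ p i ⊎ ConnSpanningSubgraph.E H (p i) (p' i)

record AdvStrategy {n : ℕ} (G : Graph n) (k : ℕ) : Set₁ where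
  field
    start    : Positions k n
    distinct : Injective _≡_ _≡_ start
    informed : Fin k
    choose   : List (Positions k n) → ConnSpanningSubgraph G

history : {k n : ℕ} → (ℕ → Positions k n) → ℕ → List (Positions k n)
history pos zero    = [ pos zero ]
history pos (suc t) = history pos t ++ [ pos (suc t) ]

module _ {n k : ℕ} {G : Graph n} (σ : AdvStrategy G k) where
  open AdvStrategy σ

  -- A play consistent with σ (agents may move arbitrarily, with full information).
  ConsistentPlay : (ℕ → Positions k n) → Set
  ConsistentPlay pos =
    pos 0 ≡ start ×
    (∀ t → LegalMove (choose (history pos t)) (pos t) (pos (suc t)))

  knowledge : (ℕ → Positions k n) → ℕ → Fin k → Bool
  knowledge pos zero    i = ⌊ i ≟ᶠ informed ⌋
  knowledge pos (suc t) = updateKnow (knowledge pos t) (pos (suc t))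

  WinningForAdversary : Set
  WinningForAdversary =
    ∀ pos → ConsistentPlay pos → ∀ t → ∃[ i ] knowledge pos t i ≡ false

AdversaryWin : {n : ℕ} → Graph n → ℕ → Set₁
AdversaryWin G k = Σ (AdvStrategy G k) WinningForAdversary

{-# OPTIONS --safe #-}
module Submission where

-- The Adversary always plays a Hamiltonian path, i.e. the Hamiltonian cycle with one edge
-- removed. Along a path every agent moves by at most one position per round, so two agents at
-- distance at least 3 on the path cannot meet in that round. When n ≥ 5, any two distinct
-- vertices are at distance at least 3 on a suitable cut of the cycle: cut just before one of
-- them, or, if the other one follows within two steps, just after it. So the two agents never
-- share a vertex and the ignorant one stays ignorant forever.

open import Defs
open import Data.Nat using (ℕ; zero; suc; _+_; _<_; _≤_; _%_; _/_; ∣_-_∣; z≤n; s≤s; NonZero)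
open import Data.Nat.Properties
open import Data.Nat.DivMod using (_mod_; m≡m%n+[m/n]*n; [m+kn]%n≡m%n; [m+n]%n≡m%n; m<n⇒m%n≡m; m%n<n; n%n≡0)
open import Data.Fin using (Fin; toℕ; punchOut) renaming (zero to fz; suc to fs; _≟_ to _≟ᶠ_)
open import Data.Fin.Properties using (toℕ-injective; toℕ<n; toℕ-fromℕ<; fromℕ<-cong; fromℕ<-injective; any?; injective⇒≤; punchOut-injective)
open import Data.Bool using (Bool; true; false; _∧_)
open import Data.Bool.Properties using (∧-zeroʳ)
open import Data.Bool.ListAction using (any)
open import Data.List using (List; []; _∷_; foldl; allFin)
open import Data.List.Properties using (foldl-∷ʳ)
open import Data.Product using (Σ-syntax; ∃-syntax; _×_; _,_; proj₁; proj₂; map₂)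
open import Data.Sum using (_⊎_; inj₁; inj₂)
open import Function using (_∘_)
open import Function.Definitions using (Injective; StrictlySurjective)
open import Relation.Binary.Definitions using (Symmetric)
open import Relation.Binary.Construct.Closure.Symmetric using (SymClosure; fwd; bwd; fold; symmetric)
open import Relation.Binary.PropositionalEquality using (_≡_; _≢_; refl; sym; trans; cong; subst; subst₂; module ≡-Reasoning)
open import Relation.Nullary using (yes; no; contradiction)
open import Relation.Nullary.Decidable using (⌊_⌋)

reach-trans : ∀ {n} {E : Fin n → Fin n → Set} {u v w} → Reach E u v → Reach E v w → Reach E u w
reach-trans here       r = r
reach-trans (step e q) r = step e (reach-trans q r)

reach-sym : ∀ {n} {E : Fin n → Fin n → Set} → Symmetric E → Symmetric (Reach E)
reach-sym E-sym here       = here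
reach-sym E-sym (step e r) = reach-trans (reach-sym E-sym r) (step (E-sym e) here)

injective⇒strictlySurjective : ∀ {n} {f : Fin n → Fin n} → Injective _≡_ _≡_ f → StrictlySurjective _≡_ f
injective⇒strictlySurjective {suc n} {f} f-inj y with any? (λ x → f x ≟ᶠ y)
... | yes hit   = hit
... | no missed = contradiction (injective⇒≤ squeezed-injective) 1+n≰n
  where
  -- If y is not a value of f, punching it out injects Fin (suc n) into Fin n.
  y≢f : ∀ x → y ≢ f x
  y≢f x = missed ∘ (x ,_) ∘ sym

  squeezed : Fin (suc n) → Fin n
  squeezed x = punchOut (y≢f x)

  squeezed-injective : Injective _≡_ _≡_ squeezed
  squeezed-injective eq = f-inj (punchOut-injective (y≢f _) (y≢f _) eq)

[1+m]%n≡[1+m%n]%n : ∀ m n .{{_ : NonZero n}} → suc m % n ≡ suc (m % n) % n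
[1+m]%n≡[1+m%n]%n m n = trans (cong (λ k → suc k % n) (m≡m%n+[m/n]*n m n)) ([m+kn]%n≡m%n (suc (m % n)) (m / n) n)

1+[m%n]≡[1+m]%n∨1+[m%n]≡n : ∀ m n .{{_ : NonZero n}} →
                       suc (m % n) ≡ suc m % n ⊎ (suc (m % n) ≡ n × suc m % n ≡ 0)
1+[m%n]≡[1+m]%n∨1+[m%n]≡n m n with m≤n⇒m<n∨m≡n (m%n<n m n)
... | inj₁ 1+r<n = inj₁ (sym (trans ([1+m]%n≡[1+m%n]%n m n) (m<n⇒m%n≡m 1+r<n)))
... | inj₂ 1+r≡n = inj₂ (1+r≡n , trans ([1+m]%n≡[1+m%n]%n m n) (trans (cong (_% n) 1+r≡n) (n%n≡0 n)))

∣m-1+m∣≤1 : ∀ m → ∣ m - suc m ∣ ≤ 1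
∣m-1+m∣≤1 zero    = ≤-refl
∣m-1+m∣≤1 (suc m) = ∣m-1+m∣≤1 m

gap-survives-unit-moves : ∀ {i j i′ j′} → 3 ≤ ∣ i - j ∣ → ∣ i - i′ ∣ ≤ 1 → ∣ j - j′ ∣ ≤ 1 → i′ ≢ j′
gap-survives-unit-moves {i} {j} {i′} far di dj refl = 1+n≰n (begin
  3                       ≤⟨ far ⟩
  ∣ i - j ∣               ≤⟨ ∣-∣-triangle i i′ j ⟩
  ∣ i - i′ ∣ + ∣ i′ - j ∣ ≡⟨ cong (∣ i - i′ ∣ +_) (∣-∣-comm i′ j) ⟩
  ∣ i - i′ ∣ + ∣ j - i′ ∣ ≤⟨ +-mono-≤ di dj ⟩
  2                       ∎)
  where open ≤-Reasoning

any-false : ∀ {A : Set} {p : A → Bool} xs → (∀ x → p x ≡ false) → any p xs ≡ false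
any-false []       _       = refl
any-false (x ∷ xs) p≡false rewrite p≡false x = any-false xs p≡false

updateKnow-unmet : ∀ {k n} (κ : Fin k → Bool) (p : Positions k n) i → κ i ≡ false →
                   (∀ j → κ j ≡ true → p j ≢ p i) → updateKnow κ p i ≡ false
updateKnow-unmet {k} κ p i κi≡false unmet rewrite κi≡false = any-false (allFin k) meets-no-knower
  where
  meets-no-knower : ∀ j → (⌊ p j ≟ᶠ p i ⌋ ∧ κ j) ≡ false
  meets-no-knower j with κ j in κj | p j ≟ᶠ p i
  ... | false | _      = ∧-zeroʳ _
  ... | true  | yes eq = contradiction eq (unmet j κj)
  ... | true  | no  _  = refl

-- Only the positions 0, …, n - 1 of a path are meaningful; vertex is arbitrary beyond them.
record HamiltonianPath {n} (G : Graph n) : Set where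
  field
    vertex    : ℕ → Fin n
    injective : ∀ {i j} → i < n → j < n → vertex i ≡ vertex j → i ≡ j
    adjacent  : ∀ {i} → suc i < n → Graph.Adj G (vertex i) (vertex (suc i))

  vertex∘toℕ-injective : Injective _≡_ _≡_ (vertex ∘ toℕ)
  vertex∘toℕ-injective eq = toℕ-injective (injective (toℕ<n _) (toℕ<n _) eq)

  surjective : ∀ v → ∃[ i ] i < n × vertex i ≡ v
  surjective v with i , eq ← injective⇒strictlySurjective vertex∘toℕ-injective v = toℕ i , toℕ<n i , eq

module _ {n} {G : Graph n} (P : HamiltonianPath G) where
  open HamiltonianPath P

  data Link : Fin n → Fin n → Set where
    link : ∀ {i} → suc i < n → Link (vertex i) (vertex (suc i))

  PathEdge : Fin n → Fin n → Set
  PathEdge = SymClosure Link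

  Move : Fin n → Fin n → Set
  Move u u′ = u′ ≡ u ⊎ PathEdge u u′

  link⇒adj : ∀ {u v} → Link u v → Graph.Adj G u v
  link⇒adj (link 1+i<n) = adjacent 1+i<n

  reach-origin : ∀ {i} → i < n → Reach PathEdge (vertex i) (vertex 0)
  reach-origin {zero}  _     = here
  reach-origin {suc i} 1+i<n = step (bwd (link 1+i<n)) (reach-origin (<-trans (n<1+n i) 1+i<n))

  path-connected : ConnectedRel PathEdge
  path-connected u v with surjective u | surjective v
  ... | _ , i<n , refl | _ , j<n , refl =
    reach-trans (reach-origin i<n) (reach-sym (symmetric Link) (reach-origin j<n))

  pathSubgraph : ConnSpanningSubgraph G
  pathSubgraph = record
    { E         = PathEdge
    ; sub       = fold (Graph.symm G) link⇒adj
    ; symm      = symmetric Link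
    ; connected = path-connected
    }

  move-index : ∀ {i u u′} → i < n → vertex i ≡ u → Move u u′ → ∃[ j ] j < n × vertex j ≡ u′ × ∣ i - j ∣ ≤ 1
  move-index {i} i<n eq (inj₁ refl) = i , i<n , eq , ≤-trans (≤-reflexive (∣n-n∣≡0 i)) z≤n
  move-index i<n eq (inj₂ (fwd (link {k} 1+k<n)))
    with refl ← injective i<n (<-trans (n<1+n k) 1+k<n) eq
    = suc k , 1+k<n , refl , ∣m-1+m∣≤1 k
  move-index i<n eq (inj₂ (bwd (link {k} 1+k<n)))
    with refl ← injective i<n 1+k<n eq
    = k , <-trans (n<1+n k) 1+k<n , refl , subst (_≤ 1) (∣-∣-comm k (suc k)) (∣m-1+m∣≤1 k)

  record Separated (u w : Fin n) : Set where
    field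
      i j      : ℕ
      i<n      : i < n
      j<n      : j < n
      vertex-i : vertex i ≡ u
      vertex-j : vertex j ≡ w
      far      : 3 ≤ ∣ i - j ∣

  separated-move-≢ : ∀ {u w u′ w′} → Separated u w → Move u u′ → Move w w′ → u′ ≢ w′
  separated-move-≢ s mu mw meet
    with i′ , i′<n , vi′ , di ← move-index (Separated.i<n s) (Separated.vertex-i s) mu
       | j′ , j′<n , vj′ , dj ← move-index (Separated.j<n s) (Separated.vertex-j s) mw
    = gap-survives-unit-moves {Separated.i s} {Separated.j s} (Separated.far s) di dj
        (injective i′<n j′<n (trans vi′ (trans meet (sym vj′))))

-- A Hamiltonian cycle unrolled along ℕ: position i holds the cycle vertex number i mod n.
record HamiltonianCycle {n} (G : Graph n) : Set where
  field
    vertex    : ℕ → Fin n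
    injective : ∀ {i j} → i < n → j < n → vertex i ≡ vertex j → i ≡ j
    adjacent  : ∀ i → Graph.Adj G (vertex i) (vertex (suc i))
    periodic  : ∀ i → vertex (i + n) ≡ vertex i

  cut : HamiltonianPath G
  cut = record { vertex = vertex ; injective = injective ; adjacent = λ {i} _ → adjacent i }

  surjective : ∀ v → ∃[ i ] i < n × vertex i ≡ v
  surjective = HamiltonianPath.surjective cut

open HamiltonianCycle

rotate : ∀ {n} {G : Graph n} → HamiltonianCycle G → HamiltonianCycle G
rotate {n} C = record
  { vertex    = vertex C ∘ suc
  ; injective = rotated-injective
  ; adjacent  = adjacent C ∘ suc
  ; periodic  = periodic C ∘ suc
  }
  where
  wrap : ∀ {i} → suc i ≡ n → vertex C (suc i) ≡ vertex C 0
  wrap 1+i≡n = trans (cong (vertex C) 1+i≡n) (periodic C 0)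

  rotated-injective : ∀ {i j} → i < n → j < n → vertex C (suc i) ≡ vertex C (suc j) → i ≡ j
  rotated-injective i<n j<n eq with m≤n⇒m<n∨m≡n i<n | m≤n⇒m<n∨m≡n j<n
  ... | inj₁ 1+i<n | inj₁ 1+j<n = suc-injective (injective C 1+i<n 1+j<n eq)
  ... | inj₂ 1+i≡n | inj₂ 1+j≡n = suc-injective (trans 1+i≡n (sym 1+j≡n))
  ... | inj₂ 1+i≡n | inj₁ 1+j<n =
    contradiction (injective C (m<n⇒0<n i<n) 1+j<n (trans (sym (wrap 1+i≡n)) eq)) λ ()
  ... | inj₁ 1+i<n | inj₂ 1+j≡n =
    contradiction (injective C 1+i<n (m<n⇒0<n i<n) (trans eq (wrap 1+j≡n))) λ ()

rotateTo-index : ∀ {n} {G : Graph n} k (C : HamiltonianCycle G) →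
                 Σ[ C′ ∈ HamiltonianCycle G ] vertex C′ 0 ≡ vertex C k
rotateTo-index zero    C = C , refl
rotateTo-index (suc k) C = rotateTo-index k (rotate C)

rotateTo : ∀ {n} {G : Graph n} (C : HamiltonianCycle G) v → Σ[ C′ ∈ HamiltonianCycle G ] vertex C′ 0 ≡ v
rotateTo C v with k , _ , refl ← surjective C v = rotateTo-index k C

module _ {m} {G : Graph (suc m)} where

  fromHamiltonian : Hamiltonian G → HamiltonianCycle G
  fromHamiltonian (_ , c , c-inj , c-adj) = record
    { vertex    = λ i → c (i mod suc m)
    ; injective = λ {i} {j} i<n j<n eq → begin
        i           ≡⟨ m<n⇒m%n≡m i<n ⟨
        i % suc m   ≡⟨ fromℕ<-injective _ _ _ _ (c-inj eq) ⟩
        j % suc m   ≡⟨ m<n⇒m%n≡m j<n ⟩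
        j           ∎
    ; adjacent  = λ i → c-adj _ _
        (subst₂ CycleSuccessor (sym (toℕ-fromℕ< _)) (sym (toℕ-fromℕ< _)) (1+[m%n]≡[1+m]%n∨1+[m%n]≡n i (suc m)))
    ; periodic  = λ i → cong c (fromℕ<-cong _ _ ([m+n]%n≡m%n i (suc m)) _ _)
    }
    where
    open ≡-Reasoning
    CycleSuccessor : ℕ → ℕ → Set
    CycleSuccessor a b = suc a ≡ b ⊎ (suc a ≡ suc m × b ≡ 0)

  separated-on-cycle : 4 ≤ m → (C : HamiltonianCycle G) → ∀ {k} → suc k < suc m →
                       Σ[ P ∈ HamiltonianPath G ] Separated P (vertex C 0) (vertex C (suc k))
  separated-on-cycle 4≤m C {k} 1+k<n with 2 ≤? k
  ... | yes 2≤k = cut C , record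
    { i = 0 ; j = suc k ; i<n = s≤s z≤n ; j<n = 1+k<n ; vertex-i = refl ; vertex-j = refl ; far = s≤s 2≤k }
  -- Too close to the origin: cut the edge leaving the origin instead, which moves it to position m.
  ... | no  2≰k = cut (rotate C) , record
    { i = m ; j = k ; i<n = ≤-refl ; j<n = <-trans (n<1+n k) 1+k<n
    ; vertex-i = periodic C 0 ; vertex-j = refl
    ; far = subst (3 ≤_) (sym (m≤n⇒∣n-m∣≡n∸m (m+n≤o⇒n≤o 3 3+k≤m))) (m+n≤o⇒m≤o∸n 3 3+k≤m)
    }
    where
    3+k≤m : 3 + k ≤ m
    3+k≤m = ≤-trans (+-monoʳ-≤ 2 (≰⇒> 2≰k)) 4≤m

  separatingPath : 4 ≤ m → HamiltonianCycle G → (u w : Fin (suc m)) →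
                   Σ[ P ∈ HamiltonianPath G ] (u ≢ w → Separated P u w)
  separatingPath 4≤m C u w with rotateTo C u
  ... | C₀ , origin≡u with surjective C₀ w
  ...   | zero  , _     , origin≡w = cut C₀ , λ u≢w → contradiction (trans (sym origin≡u) origin≡w) u≢w
  ...   | suc k , 1+k<n , at≡w     =
    map₂ (λ s _ → subst₂ (Separated _) origin≡u at≡w s) (separated-on-cycle 4≤m C₀ 1+k<n)

  module Strategy (4≤m : 4 ≤ m) (C : HamiltonianCycle G) where

    Pos : Set
    Pos = Positions 2 (suc m)

    pathFor : Pos → HamiltonianPath G
    pathFor p = proj₁ (separatingPath 4≤m C (p fz) (p (fs fz)))

    start : Pos
    start a = vertex C (toℕ a)

    start-injective : Injective _≡_ _≡_ start
    start-injective eq = toℕ-injective (injective C (toℕ<suc-m _) (toℕ<suc-m _) eq)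
      where
      toℕ<suc-m : ∀ (a : Fin 2) → toℕ a < suc m
      toℕ<suc-m a = <-≤-trans (toℕ<n a) (s≤s (≤-trans (s≤s z≤n) 4≤m))

    current : List Pos → Pos
    current = foldl (λ _ p → p) start

    current-history : ∀ pos t → current (history pos t) ≡ pos t
    current-history pos zero    = refl
    current-history pos (suc t) = foldl-∷ʳ _ start (pos (suc t)) (history pos t)

    σ : AdvStrategy G 2
    σ = record
      { start    = start
      ; distinct = start-injective
      ; informed = fz
      ; choose   = pathSubgraph ∘ pathFor ∘ current
      }

    keeps-apart : ∀ {p p′} → p fz ≢ p (fs fz) → LegalMove (pathSubgraph (pathFor p)) p p′ → p′ fz ≢ p′ (fs fz)
    keeps-apart {p} p-apart move =
      separated-move-≢ _ (proj₂ (separatingPath 4≤m C (p fz) (p (fs fz))) p-apart) (move fz) (move (fs fz))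

    apart : ∀ {pos} → ConsistentPlay σ pos → ∀ t → pos t fz ≢ pos t (fs fz)
    apart (pos0≡start , _) zero = subst (λ p → p fz ≢ p (fs fz)) (sym pos0≡start) ((λ ()) ∘ start-injective)
    apart {pos} play@(_ , moves) (suc t) = keeps-apart (apart play t)
      (subst (λ p → LegalMove (pathSubgraph (pathFor p)) (pos t) (pos (suc t))) (current-history pos t) (moves t))

    ignorant : ∀ {pos} → ConsistentPlay σ pos → ∀ t → knowledge σ pos t (fs fz) ≡ false
    ignorant play zero          = refl
    ignorant {pos} play (suc t) = updateKnow-unmet _ (pos (suc t)) (fs fz) (ignorant play t) unmet
      where
      unmet : ∀ j → knowledge σ pos t j ≡ true → pos (suc t) j ≢ pos (suc t) (fs fz)
      unmet fz      _     = apart play (suc t)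
      unmet (fs fz) knows = contradiction (trans (sym (ignorant play t)) knows) λ ()

    win : AdversaryWin G 2
    win = σ , λ pos play t → fs fz , ignorant play t

mainTheorem11 : (n : ℕ) (G : Graph n) → 5 ≤ n → Hamiltonian G → AdversaryWin G 2
mainTheorem11 _ G (s≤s 4≤m) ham = Strategy.win 4≤m (fromHamiltonian ham)
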